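{- Let $G$ be an instance of \textsc{Stable Matching} and let $S$ be the set of matchings produced by the Disjoint Stable Matchings algorithm described in the context on input $G$. Then $S$ is a chain of pairwise edge-disjoint stable matchings under the dominance relation, and there is no chain of pairwise edge-disjoint stable matchings of $G$ (under the dominance relation) with more than $|S|$ members.
   Context: An instance of \textsc{Stable Matching}: a complete bipartite graph $G$ with sides $\mathcal{M}$ (men) and $\mathcal{W}$ (women), $|\mathcal{M}|=|\mathcal{W}|=n$, where each person has a strictly ordered preference list of all persons of the other side (earlier = more preferred). For a perfect matching $M$, $p_M(x)$ is the partner of $x$. A pair $(m,w)$ blocks $M$ if $w$ prefers $m$ to $p_M(w)$ and $m$ prefers $w$ to $p_M(m)$; $M$ is stable if no pair blocks it. Dominance: a stable matching $M$ dominates a stable matching $M'$ (written $M\prec M'$) if every man gets a strictly more preferred partner in $M$ than in $M'$. A chain is a set of stable matchings totally ordered by $\prec$. "Deleting a pair $(m,w)$" means removing $m$ from $w$'s current list and $w$ from $m$'s current list. Extended Gale-Shapley (GS-Extended), operating on the current (modifiable) lists: all persons start free; while some man $m$ is free: let $w$ be the first woman on $m$'s current list; if some man $p$ is engaged to $w$, make $p$ free; engage $m$ and $w$; for each successor $m'$ of $m$ on $w$'s current list, delete the pair $(m',w)$. Return the set of engaged pairs. Disjoint Stable Matchings algorithm on input $G$: set $S\gets\varnothing$. Compute the woman-optimal stable matching $M_z$ of $G$ (by the woman-proposing Gale-Shapley algorithm on the original lists). Set $X\gets$ GS-Extended$(G)$ (modifying the lists). While $X\cap M_z=\varnothing$: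 put $S\gets S\cup\{X\}$; for every man $m$, delete the first woman $w$ on $m$'s current list (which is $m$'s partner in $X$) and delete the last man on $w$'s current list (which is $w$'s partner in $X$); then set $X\gets$ GS-Extended on the current lists. After the loop, put $S\gets S\cup\{M_z\}$ and return $S$. -}

module Defs where

open import Data.Nat using (ℕ; _≤_)
open import Data.Fin using (Fin; _≟_)
open import Data.Bool using (Bool; true; false; if_then_else_; not)
open import Data.Maybe using (Maybe; just; nothing)
open import Data.Product using (Σ; ∃; _×_; _,_)
open import Data.Sum using (_⊎_)
open import Data.List using (List; []; _∷_; _++_; [_]; head; last; allFin; concatMap; filterᵇ; foldl; map; length)
open import Data.List.Relation.Binary.Permutation.Propositional using (_↭_)
open import Data.List.Relation.Unary.All using (All)
open import Data.List.Relation.Unary.AllPairs using (AllPairs)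
open import Relation.Binary.PropositionalEquality using (_≡_; _≢_)
open import Relation.Binary.Construct.Closure.ReflexiveTransitive using (Star)
open import Relation.Nullary using (¬_; does)
open import Function.Definitions using (Injective)

-- Men and women are both Fin n.  mpref m is man m's
-- preference list of women (earlier = more preferred), wpref w is woman
-- w's preference list of men.  Each list is a strict total order of all
-- persons of the other side, i.e. a permutation of allFin n.

record Instance (n : ℕ) : Set where
  field
    mpref : Fin n → List (Fin n)
    wpref : Fin n → List (Fin n)
    mpref-perm : ∀ m → mpref m ↭ allFin n
    wpref-perm : ∀ w → wpref w ↭ allFin n
open Instance public

Before : ∀ {n} → List (Fin n) → Fin n → Fin n → Set
Before l a b = Σ (List _) λ p → Σ (List _) λ q → Σ (List _) λ r →
  l ≡ p ++ a ∷ q ++ b ∷ r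

WeaklyBefore : ∀ {n} → List (Fin n) → Fin n → Fin n → Set
WeaklyBefore l a b = a ≡ b ⊎ Before l a b

-- Matchings: a matching assigns to each man a woman (his partner);
-- it is perfect iff this assignment is injective (hence bijective).

Matching : ℕ → Set
Matching n = Fin n → Fin n

Perfect : ∀ {n} → Matching n → Set
Perfect μ = Injective _≡_ _≡_ μ

Blocks : ∀ {n} → Instance n → Matching n → Fin n → Fin n → Set
Blocks G μ m w = Before (mpref G m) w (μ m)
               × (∀ m' → μ m' ≡ w → Before (wpref G w) m m')

Stable : ∀ {n} → Instance n → Matching n → Set
Stable G μ = Perfect μ × (∀ m w → ¬ Blocks G μ m w)

Dominates : ∀ {n} → Instance n → Matching n → Matching n → Set
Dominates G M M' = ∀ m → Before (mpref G m) (M m) (M' m)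

Comparable : ∀ {n} → Instance n → Matching n → Matching n → Set
Comparable G M M' = Dominates G M M' ⊎ Dominates G M' M

EdgeDisjoint : ∀ {n} → Matching n → Matching n → Set
EdgeDisjoint M M' = ∀ m → M m ≢ M' m

-- a list of matchings forming a chain of pairwise edge-disjoint stable
-- matchings (comparability of all pairs of list entries also forces the
-- entries to be distinct, since ≺ is irreflexive)
DisjointStableChain : ∀ {n} → Instance n → List (Matching n) → Set
DisjointStableChain G C =
  All (Stable G) C × AllPairs (Comparable G) C × AllPairs EdgeDisjoint C

WomanOptimal : ∀ {n} → Instance n → Matching n → Set
WomanOptimal G Mz = Stable G Mz ×
  (∀ M → Stable G M → ∀ m m' → Mz m ≡ M m' → WeaklyBefore (wpref G (Mz m)) m m')

record Lists (n : ℕ) : Set where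
  constructor ⟨_,_⟩
  field
    mlist : Fin n → List (Fin n)
    wlist : Fin n → List (Fin n)
open Lists public

initialLists : ∀ {n} → Instance n → Lists n
initialLists G = ⟨ mpref G , wpref G ⟩

removeFrom : ∀ {n} → Fin n → List (Fin n) → List (Fin n)
removeFrom x = filterᵇ (λ y → not (does (y ≟ x)))

deletePair : ∀ {n} → Lists n → Fin n × Fin n → Lists n
deletePair L (m , w) =
  ⟨ (λ m' → if does (m' ≟ m) then removeFrom w (mlist L m') else mlist L m')
  , (λ w' → if does (w' ≟ w) then removeFrom m (wlist L w') else wlist L w') ⟩

deletePairs : ∀ {n} → Lists n → List (Fin n × Fin n) → Lists n
deletePairs = foldl deletePair

-- GS-Extended, as a (nondeterministic) transition system.
-- Engagement: for each man, the woman he is engaged to (if any).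

Engagement : ℕ → Set
Engagement n = Fin n → Maybe (Fin n)

allFree : ∀ {n} → Engagement n
allFree _ = nothing

successors : ∀ {n} → Fin n → List (Fin n) → List (Fin n)
successors m [] = []
successors m (x ∷ xs) = if does (x ≟ m) then xs else successors m xs

freeIfWith : ∀ {n} → Fin n → Maybe (Fin n) → Maybe (Fin n)
freeIfWith w nothing = nothing
freeIfWith w (just w') = if does (w' ≟ w) then nothing else just w'

engage : ∀ {n} → Engagement n → Fin n → Fin n → Engagement n
engage E m w m' = if does (m' ≟ m) then just w else freeIfWith w (E m')

GSState : ℕ → Set
GSState n = Lists n × Engagement n

data GSStep {n : ℕ} : GSState n → GSState n → Set where
  propose : ∀ L E m w → E m ≡ nothing → head (mlist L m) ≡ just w →
    GSStep (L , E)
           (deletePairs L (map (λ m' → (m' , w)) (successors m (wlist L w)))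
           , engage E m w)

-- GSExtended L L' X : starting from current lists L (all persons free),
-- some run of GS-Extended terminates (no free man left) with modified
-- lists L' and returns the set of engaged pairs X = {(m , X m)}.
GSExtended : ∀ {n} → Lists n → Lists n → Matching n → Set
GSExtended {n} L L' X = Σ (Engagement n) λ E →
  Star GSStep (L , allFree) (L' , E) × (∀ m → E m ≡ just (X m))

roundPairs : ∀ {n} → Lists n → List (Fin n × Fin n)
roundPairs {n} L = concatMap pairsOf (allFin n)
  where
  lastOf : Fin n → List (Fin n × Fin n)
  lastOf w with last (wlist L w)
  ... | nothing = []
  ... | just m' = [ (m' , w) ]
  pairsOf : Fin n → List (Fin n × Fin n)
  pairsOf m with head (mlist L m)
  ... | nothing = []
  ... | just w = (m , w) ∷ lastOf w

-- DSMLoop Mz L X S : the while-loop, entered with current lists L and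
-- current matching X, terminates and the matchings it adds to S
-- (including the final M_z) are exactly those in the list S.
data DSMLoop {n : ℕ} (Mz : Matching n) : Lists n → Matching n → List (Matching n) → Set where
  finish : ∀ L X → (∃ λ m → X m ≡ Mz m) → DSMLoop Mz L X (Mz ∷ [])
  iterate : ∀ L X L' X' S → (∀ m → X m ≢ Mz m) →
    GSExtended (deletePairs L (roundPairs L)) L' X' →
    DSMLoop Mz L' X' S → DSMLoop Mz L X (X ∷ S)

-- DSM G S : S is a possible output of the algorithm on input G
DSM : ∀ {n} → Instance n → List (Matching n) → Set
DSM {n} G S = Σ (Matching n) λ Mz → WomanOptimal G Mz ×
  Σ (Lists n) λ L → Σ (Matching n) λ X →
    GSExtended (initialLists G) L X × DSMLoop Mz L X S

-- The current lists stay sublists of the preference lists, stay symmetric (w is on m's list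
-- iff m is on w's), and a woman's list only ever loses a final segment.  Under these invariants
-- GS-Extended behaves like Gale–Shapley on the current lists: it never deletes a pair of a
-- stable matching admitted by them, and its output X is stable, the man-optimal admitted
-- matching, and each woman's partner is the last man on her list.  A round of the loop therefore
-- deletes exactly the pairs of X, so the next output is edge-disjoint from X and dominated by
-- it, while every stable matching edge-disjoint from X stays admitted.  Since M_z is the
-- man-pessimal stable matching, it stays admitted throughout and the loop stops when X meets
-- M_z.  In a chain of admitted edge-disjoint stable matchings at most one member meets the
-- man-optimal X, so each round loses at most one member of a chain, and no chain is longer
-- than S.

module Submission where

open import Defs
open import Data.Fin using (Fin; zero; _≟_; punchOut)
open import Data.Fin.Properties using (any?; injective⇒≤; punchOut-injective)
open import Data.List using (List; []; _∷_; head; last; length; map; allFin)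
open import Data.List.Membership.Propositional using (_∈_; _∉_)
open import Data.List.Membership.Propositional.Properties
  using (∈-∃++; ∈-++⁺ʳ; ∈-allFin; ∈-filter⁻; ∈-filter⁺; ∈-map⁺; ∈-map⁻; ∈-concat⁺′; ∈-concat⁻′)
open import Data.List.Relation.Binary.Permutation.Propositional using (_↭_; ↭-sym; ↭⇒↭ₛ)
open import Data.List.Relation.Binary.Permutation.Propositional.Properties using (∈-resp-↭)
open import Data.List.Relation.Binary.Permutation.Setoid.Properties using (Unique-resp-↭)
open import Data.List.Relation.Binary.Pointwise using (Pointwise-≡⇒≡)
open import Data.List.Relation.Binary.Sublist.Heterogeneous.Properties using (toPointwise)
open import Data.List.Relation.Binary.Sublist.Propositional using (_⊆_; []; _∷_; _∷ʳ_; ⊆-refl; ⊆-trans)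
open import Data.List.Relation.Binary.Sublist.Propositional.Properties
  using (All-resp-⊆; Any-resp-⊆; filter-⊆; length-mono-≤)
open import Data.List.Relation.Unary.All as All using (All; []; _∷_)
open import Data.List.Relation.Unary.AllPairs using (AllPairs; []; _∷_)
open import Data.List.Relation.Unary.Any as Any using (here; there)
open import Data.List.Relation.Unary.Unique.Propositional using (Unique)
open import Data.List.Relation.Unary.Unique.Propositional.Properties using (allFin⁺)
open import Data.Bool using (T; not)
open import Data.Empty using (⊥-elim)
open import Data.Maybe using (Maybe; just; nothing)
open import Data.Maybe.Properties using (≡-dec; just-injective)
open import Data.Nat using (ℕ; zero; suc; _+_; _≤_; _<_; z≤n; s≤s)
open import Data.Nat.Induction using (<-wellFounded)
open import Data.Nat.ListAction using (sum)
open import Data.Nat.Properties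
  using ( ≤-refl; ≤-trans; ≤-antisym; <-irrefl; <-asym; <-trans; ≤-<-trans; <-≤-trans; <⇒≤; <⇒≢; <⇒≱
        ; ≤∧≢⇒<; ≮⇒≥; m≤n⇒m<n∨m≡n; m≤n⇒m≤1+n; 1+n≰n; suc-injective; +-mono-≤; +-mono-<-≤; +-mono-≤-<)
open import Data.Product using (Σ; ∃; _×_; _,_; proj₁; proj₂; map₁)
open import Data.Sum using (_⊎_; inj₁; inj₂)
open import Data.Unit using (⊤; tt)
open import Function using (_∘_; _∋_; case_of_)
open import Function.Definitions using (Injective)
open import Induction.WellFounded using (Acc; acc)
open import Relation.Binary.Core using (Rel)
open import Relation.Binary.Construct.Closure.ReflexiveTransitive using (Star; ε; _◅_)
open import Relation.Binary.Definitions using (Asymmetric)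
open import Relation.Binary.PropositionalEquality
  using (_≡_; _≢_; refl; sym; trans; cong; subst; subst₂; setoid)
open import Relation.Nullary using (¬_; Dec; yes; no; does; contradiction)
open import Relation.Nullary.Decidable using (T?)
open import Relation.Unary using (Pred)

≢nothing⇒just : ∀ {a} {A : Set a} {e : Maybe A} → e ≢ nothing → ∃ λ x → e ≡ just x
≢nothing⇒just {e = nothing} e≢nothing = contradiction refl e≢nothing
≢nothing⇒just {e = just x}  _         = x , refl

sum-map-mono-≤ : ∀ {a} {A : Set a} (f g : A → ℕ) xs → (∀ x → f x ≤ g x) →
  sum (map f xs) ≤ sum (map g xs)
sum-map-mono-≤ f g []       f≤g = z≤n
sum-map-mono-≤ f g (x ∷ xs) f≤g = +-mono-≤ (f≤g x) (sum-map-mono-≤ f g xs f≤g)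

sum-map-mono-< : ∀ {a} {A : Set a} (f g : A → ℕ) xs → (∀ x → f x ≤ g x) →
  ∀ {x} → x ∈ xs → f x < g x → sum (map f xs) < sum (map g xs)
sum-map-mono-< f g (_ ∷ xs) f≤g (here refl) fx<gx = +-mono-<-≤ fx<gx (sum-map-mono-≤ f g xs f≤g)
sum-map-mono-< f g (y ∷ xs) f≤g (there x∈) fx<gx =
  +-mono-≤-< (f≤g y) (sum-map-mono-< f g xs f≤g x∈ fx<gx)

injective⇒surjective : ∀ {n} {f : Fin n → Fin n} → Injective _≡_ _≡_ f → ∀ y → ∃ λ x → f x ≡ y
injective⇒surjective {suc k} {f} f-injective y with any? (λ x → f x ≟ y)
... | yes hit = hit
... | no miss = contradiction (injective⇒≤ punched-injective) 1+n≰n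
  where
  avoids : ∀ x → y ≢ f x
  avoids x y≡fx = miss (x , sym y≡fx)
  punched : Fin (suc k) → Fin k
  punched x = punchOut (avoids x)
  punched-injective : Injective _≡_ _≡_ punched
  punched-injective {x} {x′} eq = f-injective (punchOut-injective (avoids x) (avoids x′) eq)

module _ {a} {A : Set a} where

  private
    variable
      x y w : A
      xs ys : List A

  head-just : x ∈ xs → ∃ λ y → head xs ≡ just y
  head-just {xs = y ∷ _} _ = y , refl

  last-just : x ∈ xs → ∃ λ y → last xs ≡ just y
  last-just {xs = y ∷ []}    _ = y , refl
  last-just {xs = _ ∷ z ∷ zs} _ = last-just {xs = z ∷ zs} (here refl)

  head-∈ : head xs ≡ just x → x ∈ xs
  head-∈ {_ ∷ _} refl = here refl

  last-∈ : last xs ≡ just y → y ∈ xs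
  last-∈ {_ ∷ []}    refl = here refl
  last-∈ {_ ∷ _ ∷ _} eq   = there (last-∈ eq)

  ⊆-length-< : ∀ {ys} → xs ⊆ ys → x ∈ ys → x ∉ xs → length xs < length ys
  ⊆-length-< σ x∈ys x∉xs = ≤∧≢⇒< (length-mono-≤ σ)
    (λ eq → x∉xs (subst (_ ∈_) (sym (Pointwise-≡⇒≡ (toPointwise eq σ))) x∈ys))

  mapAllPairs-within : ∀ {p ℓ₁ ℓ₂} {P : Pred A p} {R : Rel A ℓ₁} {S : Rel A ℓ₂} →
    (∀ {a b} → P a → P b → R a b → S a b) → All P xs → AllPairs R xs → AllPairs S xs
  mapAllPairs-within f []       []       = []
  mapAllPairs-within f (p ∷ ps) (r ∷ rs) =
    All.zipWith (λ (q , s) → f p q s) (ps , r) ∷ mapAllPairs-within f ps rs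

  module _ {ℓ} {R : Rel A ℓ} where

    AllPairs-resp-⊆ : xs ⊆ ys → AllPairs R ys → AllPairs R xs
    AllPairs-resp-⊆ []         []       = []
    AllPairs-resp-⊆ (_ ∷ʳ σ)   (_ ∷ rs) = AllPairs-resp-⊆ σ rs
    AllPairs-resp-⊆ (refl ∷ σ) (r ∷ rs) = All-resp-⊆ σ r ∷ AllPairs-resp-⊆ σ rs

    head-least : AllPairs R xs → head xs ≡ just w → x ∈ xs → x ≡ w ⊎ R w x
    head-least (_ ∷ _) refl (here refl) = inj₁ refl
    head-least (r ∷ _) refl (there x∈)  = inj₂ (All.lookup r x∈)

    head-⊆ : Asymmetric R → AllPairs R ys → xs ⊆ ys → head ys ≡ just w → w ∈ xs → head xs ≡ just w
    head-⊆ {xs = h ∷ _} asym rs σ hd w∈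
      with head-least (AllPairs-resp-⊆ σ rs) refl w∈ | head-least rs hd (Any-resp-⊆ σ (here refl))
    ... | inj₁ w≡h | _        = cong just (sym w≡h)
    ... | inj₂ _   | inj₁ h≡w = cong just h≡w
    ... | inj₂ hRw | inj₂ wRh = contradiction hRw (asym wRh)

    last-greatest : AllPairs R xs → last xs ≡ just y → x ∈ xs → x ≡ y ⊎ R x y
    last-greatest {_ ∷ []}    _        refl (here refl) = inj₁ refl
    last-greatest {_ ∷ _ ∷ _} (r ∷ _)  eq   (here refl) = inj₂ (All.lookup r (last-∈ eq))
    last-greatest {_ ∷ _ ∷ _} (_ ∷ rs) eq   (there x∈)  = last-greatest rs eq x∈

module _ {n : ℕ} where

  private
    variable
      x y m w : Fin n
      xs l : List (Fin n)

  module _ {ℓ} {R : Rel (Fin n) ℓ} where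

    Before⇒related : AllPairs R l → Before l x y → R x y
    Before⇒related (r ∷ _)  ([]    , q , _ , refl) = All.lookup r (∈-++⁺ʳ q (here refl))
    Before⇒related (_ ∷ rs) (_ ∷ p , q , s , refl) = Before⇒related rs (p , q , s , refl)

    ∈-successors⁻ : AllPairs R xs → x ∈ successors m xs → x ∈ xs × R m x
    ∈-successors⁻ {y ∷ _} {m = m} (r ∷ rs) x∈ with y ≟ m
    ... | yes refl = there x∈ , All.lookup r x∈
    ... | no _     = map₁ there (∈-successors⁻ rs x∈)

    ∈-successors⁺ : Asymmetric R → AllPairs R xs → m ∈ xs → x ∈ xs → R m x → x ∈ successors m xs
    ∈-successors⁺ {y ∷ _} {m} asym (r ∷ rs) m∈ x∈ mRx with y ≟ m | m∈ | x∈
    ... | yes refl | _          | here refl = contradiction mRx (asym mRx)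
    ... | yes refl | _          | there x∈′ = x∈′
    ... | no y≢m   | here m≡y   | _         = contradiction (sym m≡y) y≢m
    ... | no _     | there m∈′  | here refl = contradiction mRx (asym (All.lookup r m∈′))
    ... | no _     | there m∈′  | there x∈′ = ∈-successors⁺ asym rs m∈′ x∈′ mRx

  position : Fin n → List (Fin n) → ℕ
  position x []      = 0
  position x (y ∷ l) with x ≟ y
  ... | yes _ = 0
  ... | no  _ = suc (position x l)

  position-here : position y (y ∷ l) ≡ 0
  position-here {y} with y ≟ y
  ... | yes _  = refl
  ... | no y≢y = contradiction refl y≢y

  position-there : y ≢ x → position x (y ∷ l) ≡ suc (position x l)
  position-there {y} {x} y≢x with x ≟ y
  ... | yes x≡y = contradiction (sym x≡y) y≢x
  ... | no _    = refl

  position-injective : x ∈ l → position x l ≡ position y l → x ≡ y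
  position-injective {x} {z ∷ _} {y} x∈ eq with x ≟ z | y ≟ z
  ... | yes x≡z | yes y≡z = trans x≡z (sym y≡z)
  ... | no x≢z  | no _    = position-injective (Any.tail x≢z x∈) (suc-injective eq)
  position-injective _ () | yes _ | no _
  position-injective _ () | no _  | yes _

  position-sorted : Unique l → AllPairs (λ a b → position a l < position b l) l
  position-sorted {[]}    []       = []
  position-sorted {y ∷ l} (y∉ ∷ u) = All.map head< y∉ ∷ mapAllPairs-within shift y∉ (position-sorted u)
    where
    head< : ∀ {b} → y ≢ b → position y (y ∷ l) < position b (y ∷ l)
    head< y≢b rewrite position-here {y} {l} | position-there {l = l} y≢b = s≤s z≤n
    shift : ∀ {a b} → y ≢ a → y ≢ b → position a l < position b l →
      position a (y ∷ l) < position b (y ∷ l)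
    shift y≢a y≢b a<b rewrite position-there {l = l} y≢a | position-there {l = l} y≢b = s≤s a<b

  position<⇒Before : y ∈ l → position x l < position y l → Before l x y
  position<⇒Before {y} {z ∷ l} {x} y∈ x<y with x ≟ z | y ≟ z
  ... | _      | yes _   = contradiction x<y (λ ())
  position<⇒Before (here y≡z) _ | _ | no y≢z = contradiction y≡z y≢z
  position<⇒Before {y} {z ∷ l} {x} (there y∈) _ | yes refl | no _ with q , r , eq ← ∈-∃++ y∈ =
    [] , q , r , cong (x ∷_) eq
  position<⇒Before {y} {z ∷ l} {x} (there y∈) (s≤s x<y) | no _ | no _
    with p , q , r , eq ← position<⇒Before y∈ x<y = z ∷ p , q , r , cong (z ∷_) eq

module Profile {n : ℕ} (pref : Fin n → List (Fin n)) (pref-perm : ∀ x → pref x ↭ allFin n) where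

  rank : Fin n → Fin n → ℕ
  rank x y = position y (pref x)

  ∈-pref : ∀ x y → y ∈ pref x
  ∈-pref x y = ∈-resp-↭ (↭-sym (pref-perm x)) (∈-allFin y)

  pref-unique : ∀ x → Unique (pref x)
  pref-unique x = Unique-resp-↭ (setoid (Fin n)) (↭⇒↭ₛ (↭-sym (pref-perm x))) (allFin⁺ n)

  ⊆-pref-sorted : ∀ {x xs} → xs ⊆ pref x → AllPairs (λ a b → rank x a < rank x b) xs
  ⊆-pref-sorted {x} σ = AllPairs-resp-⊆ σ (position-sorted (pref-unique x))

  rank-injective : ∀ x {a b} → rank x a ≡ rank x b → a ≡ b
  rank-injective x {a} = position-injective (∈-pref x a)

  Before⇒rank< : ∀ {x a b} → Before (pref x) a b → rank x a < rank x b
  Before⇒rank< {x} = Before⇒related (position-sorted (pref-unique x))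

  rank<⇒Before : ∀ {x a b} → rank x a < rank x b → Before (pref x) a b
  rank<⇒Before {x} {b = b} = position<⇒Before (∈-pref x b)

-- Deleting pairs from the current lists

module _ {n : ℕ} where

  private
    variable
      x y m w a b : Fin n
      xs : List (Fin n)
      L : Lists n

  private
    kept? : (x y : Fin n) → Dec (T (not (does (y ≟ x))))
    kept? x y = T? (not (does (y ≟ x)))

  removeFrom-⊆ : removeFrom x xs ⊆ xs
  removeFrom-⊆ {x} {xs} = filter-⊆ (kept? x) xs

  ∈-removeFrom⁻ : y ∈ removeFrom x xs → y ≢ x
  ∈-removeFrom⁻ {y} {x} {xs} y∈ with y ≟ x | proj₂ (∈-filter⁻ (kept? x) {xs = xs} y∈)
  ... | no y≢x | _ = y≢x

  ∈-removeFrom⁺ : y ∈ xs → y ≢ x → y ∈ removeFrom x xs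
  ∈-removeFrom⁺ {y} {x = x} y∈ y≢x = ∈-filter⁺ (kept? x) y∈ kept
    where
    kept : T (not (does (y ≟ x)))
    kept with y ≟ x
    ... | yes y≡x = contradiction y≡x y≢x
    ... | no _    = _

  _⊑_ : Lists n → Lists n → Set
  L′ ⊑ L = (∀ m → mlist L′ m ⊆ mlist L m) × (∀ w → wlist L′ w ⊆ wlist L w)

  ⊑-refl : L ⊑ L
  ⊑-refl = (λ _ → ⊆-refl) , (λ _ → ⊆-refl)

  ⊑-trans : ∀ {L₁ L₂ L₃ : Lists n} → L₁ ⊑ L₂ → L₂ ⊑ L₃ → L₁ ⊑ L₃
  ⊑-trans (σᵐ , σʷ) (τᵐ , τʷ) = (λ m → ⊆-trans (σᵐ m) (τᵐ m)) , (λ w → ⊆-trans (σʷ w) (τʷ w))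

  deletePair-⊑ : ∀ L p → deletePair L p ⊑ L
  deletePair-⊑ L (a , b) = men , women
    where
    men : ∀ m → mlist (deletePair L (a , b)) m ⊆ mlist L m
    men m with m ≟ a
    ... | yes _ = removeFrom-⊆
    ... | no _  = ⊆-refl
    women : ∀ w → wlist (deletePair L (a , b)) w ⊆ wlist L w
    women w with w ≟ b
    ... | yes _ = removeFrom-⊆
    ... | no _  = ⊆-refl

  deletePairs-⊑ : ∀ L ps → deletePairs L ps ⊑ L
  deletePairs-⊑ L []      = ⊑-refl
  deletePairs-⊑ L (p ∷ ps) = ⊑-trans (deletePairs-⊑ (deletePair L p) ps) (deletePair-⊑ L p)

  ∉-deletePairᵐ : w ∈ mlist (deletePair L (a , b)) m → (m , w) ≢ (a , b)
  ∉-deletePairᵐ {L = L} {m = m} w∈ refl with m ≟ m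
  ... | yes _   = ∈-removeFrom⁻ {xs = mlist L m} w∈ refl
  ... | no m≢m  = m≢m refl

  ∉-deletePairʷ : m ∈ wlist (deletePair L (a , b)) w → (m , w) ≢ (a , b)
  ∉-deletePairʷ {L = L} {w = w} m∈ refl with w ≟ w
  ... | yes _   = ∈-removeFrom⁻ {xs = wlist L w} m∈ refl
  ... | no w≢w  = w≢w refl

  ∈-deletePairᵐ : w ∈ mlist L m → (m , w) ≢ (a , b) → w ∈ mlist (deletePair L (a , b)) m
  ∈-deletePairᵐ {m = m} {a = a} w∈ ne with m ≟ a
  ... | yes refl = ∈-removeFrom⁺ w∈ (λ w≡b → ne (cong (m ,_) w≡b))
  ... | no _     = w∈

  ∈-deletePairʷ : m ∈ wlist L w → (m , w) ≢ (a , b) → m ∈ wlist (deletePair L (a , b)) w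
  ∈-deletePairʷ {w = w} {b = b} m∈ ne with w ≟ b
  ... | yes refl = ∈-removeFrom⁺ m∈ (λ m≡a → ne (cong (_, w) m≡a))
  ... | no _     = m∈

  ∉-deletePairsᵐ : ∀ L ps → w ∈ mlist (deletePairs L ps) m → (m , w) ∉ ps
  ∉-deletePairsᵐ L (p ∷ ps) w∈ (here eq) =
    ∉-deletePairᵐ {L = L} (Any-resp-⊆ (proj₁ (deletePairs-⊑ (deletePair L p) ps) _) w∈) eq
  ∉-deletePairsᵐ L (p ∷ ps) w∈ (there i) = ∉-deletePairsᵐ (deletePair L p) ps w∈ i

  ∉-deletePairsʷ : ∀ L ps → m ∈ wlist (deletePairs L ps) w → (m , w) ∉ ps
  ∉-deletePairsʷ L (p ∷ ps) m∈ (here eq) =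
    ∉-deletePairʷ {L = L} (Any-resp-⊆ (proj₂ (deletePairs-⊑ (deletePair L p) ps) _) m∈) eq
  ∉-deletePairsʷ L (p ∷ ps) m∈ (there i) = ∉-deletePairsʷ (deletePair L p) ps m∈ i

  ∈-deletePairsᵐ : ∀ L ps → w ∈ mlist L m → (m , w) ∉ ps → w ∈ mlist (deletePairs L ps) m
  ∈-deletePairsᵐ L []       w∈ _   = w∈
  ∈-deletePairsᵐ L (p ∷ ps) w∈ ∉ps =
    ∈-deletePairsᵐ (deletePair L p) ps (∈-deletePairᵐ {L = L} w∈ (∉ps ∘ here)) (∉ps ∘ there)

  ∈-deletePairsʷ : ∀ L ps → m ∈ wlist L w → (m , w) ∉ ps → m ∈ wlist (deletePairs L ps) w
  ∈-deletePairsʷ L []       m∈ _   = m∈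
  ∈-deletePairsʷ L (p ∷ ps) m∈ ∉ps =
    ∈-deletePairsʷ (deletePair L p) ps (∈-deletePairʷ {L = L} m∈ (∉ps ∘ here)) (∉ps ∘ there)

  private
    variable
      E : Engagement n
      m′ w′ : Fin n

  women-engaged⇒men-engaged : (∀ w → ∃ λ m → E m ≡ just w) → ∀ m → ∃ λ w → E m ≡ just w
  women-engaged⇒men-engaged {E} partner m with injective⇒surjective partner-injective m
    where
    partner-injective : Injective _≡_ _≡_ (proj₁ ∘ partner)
    partner-injective {w} {w′} same = just-injective
      (trans (sym (proj₂ (partner w)))
             (subst (λ m → E m ≡ just w′) (sym same) (proj₂ (partner w′))))
  ... | w , refl = w , proj₂ (partner w)

  engage-self : engage E m w m ≡ just w
  engage-self {m = m} with m ≟ m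
  ... | yes _  = refl
  ... | no m≢m = contradiction refl m≢m

  engage⁻ : engage E m w m′ ≡ just w′ → (m′ ≡ m × w′ ≡ w) ⊎ (E m′ ≡ just w′ × w′ ≢ w)
  engage⁻ {E} {m} {w} {m′} eq with m′ ≟ m
  engage⁻ refl | yes m′≡m = inj₁ (m′≡m , refl)
  engage⁻ {E} {m} {w} {m′} eq | no _ with E m′
  ... | just w″ with w″ ≟ w
  engage⁻ refl | no _ | just _ | no w″≢w = inj₂ (refl , w″≢w)

  engage-keeps : E m ≡ nothing → E m′ ≡ just w′ → w′ ≢ w → engage E m w m′ ≡ just w′
  engage-keeps {E} {m} {m′} {w′} {w} free engaged w′≢w with m′ ≟ m
  ... | yes refl = contradiction (trans (sym free) engaged) λ ()
  ... | no _ rewrite engaged with w′ ≟ w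
  ...   | yes w′≡w = contradiction w′≡w w′≢w
  ...   | no _     = refl

-- Invariants of the current lists

module Algorithm {n : ℕ} (G : Instance n) where

  open import Data.List.Membership.DecPropositional (_≟_ {n}) using (_∈?_)

  module Man   = Profile (mpref G) (mpref-perm G)
  module Woman = Profile (wpref G) (wpref-perm G)

  private
    variable
      m m′ w w′ a : Fin n
      L L₀ : Lists n
      E : Engagement n
      ps : List (Fin n × Fin n)

  Admits : Lists n → Matching n → Set
  Admits L M = ∀ m → M m ∈ mlist L m

  record Valid (L : Lists n) : Set where
    field
      ⊑-initial       : L ⊑ initialLists G
      ∈ᵐ⇒∈ʷ           : w ∈ mlist L m → m ∈ wlist L w
      ∈ʷ⇒∈ᵐ           : m ∈ wlist L w → w ∈ mlist L m
      keeps-preferred : m′ ∈ wlist L w → Woman.rank w m < Woman.rank w m′ → m ∈ wlist L w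

    mlist-sorted : ∀ m → AllPairs (λ a b → Man.rank m a < Man.rank m b) (mlist L m)
    mlist-sorted m = Man.⊆-pref-sorted (proj₁ ⊑-initial m)

    wlist-sorted : ∀ w → AllPairs (λ a b → Woman.rank w a < Woman.rank w b) (wlist L w)
    wlist-sorted w = Woman.⊆-pref-sorted (proj₂ ⊑-initial w)

    head-minimal : head (mlist L m) ≡ just w → w′ ∈ mlist L m → Man.rank m w ≤ Man.rank m w′
    head-minimal {m} hd w′∈ with head-least (mlist-sorted m) hd w′∈
    ... | inj₁ refl = ≤-refl
    ... | inj₂ w<w′ = <⇒≤ w<w′

  initial-valid : Valid (initialLists G)
  initial-valid = record
    { ⊑-initial       = ⊑-refl
    ; ∈ᵐ⇒∈ʷ           = λ {w} {m} _ → Woman.∈-pref w m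
    ; ∈ʷ⇒∈ᵐ           = λ {m} {w} _ → Man.∈-pref m w
    ; keeps-preferred = λ {_} {w} {m} _ _ → Woman.∈-pref w m
    }

  deletePairs-valid : Valid L →
    (∀ {a w m′} → (a , w) ∈ ps → m′ ∈ wlist L w → Woman.rank w a < Woman.rank w m′ → (m′ , w) ∈ ps) →
    Valid (deletePairs L ps)
  deletePairs-valid {L} {ps} V suffix = record
    { ⊑-initial       = ⊑-trans (deletePairs-⊑ L ps) ⊑-initial
    ; ∈ᵐ⇒∈ʷ           = λ w∈ → ∈-deletePairsʷ L ps (∈ᵐ⇒∈ʷ (⊑ᵐ w∈)) (∉-deletePairsᵐ L ps w∈)
    ; ∈ʷ⇒∈ᵐ           = λ m∈ → ∈-deletePairsᵐ L ps (∈ʷ⇒∈ᵐ (⊑ʷ m∈)) (∉-deletePairsʷ L ps m∈)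
    ; keeps-preferred = λ m′∈ m<m′ → ∈-deletePairsʷ L ps (keeps-preferred (⊑ʷ m′∈) m<m′)
                          (λ del → ∉-deletePairsʷ L ps m′∈ (suffix del (⊑ʷ m′∈) m<m′))
    }
    where
    open Valid V
    ⊑ᵐ : w ∈ mlist (deletePairs L ps) m → w ∈ mlist L m
    ⊑ᵐ = Any-resp-⊆ (proj₁ (deletePairs-⊑ L ps) _)
    ⊑ʷ : m ∈ wlist (deletePairs L ps) w → m ∈ wlist L w
    ⊑ʷ = Any-resp-⊆ (proj₂ (deletePairs-⊑ L ps) _)

  -- GS-Extended

  record GSInvariant (L₀ L : Lists n) (E : Engagement n) : Set where
    field
      valid         : Valid L
      ⊑-start       : L ⊑ L₀
      admits-stable : ∀ M → Stable G M → Admits L₀ M → Admits L M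
      engaged-head  : E m ≡ just w → head (mlist L m) ≡ just w
      engaged-last  : E m ≡ just w → m′ ∈ wlist L w → Woman.rank w m′ ≤ Woman.rank w m

  GSInvariant-start : Valid L → GSInvariant L L allFree
  GSInvariant-start V = record
    { valid = V ; ⊑-start = ⊑-refl ; admits-stable = λ _ _ adm → adm
    ; engaged-head = λ () ; engaged-last = λ () }

  unmatched : Maybe (Fin n) → ℕ
  unmatched nothing  = 1
  unmatched (just _) = 0

  -- Each proposal engages a free man, and a man it frees loses a woman from his list.
  potential : Lists n → Engagement n → ℕ
  potential L E = sum (map (λ m → unmatched (E m) + length (mlist L m)) (allFin n))

  module Proposal {L₀ L E} (I : GSInvariant L₀ L E) {m w} (free : E m ≡ nothing)
                  (hd : head (mlist L m) ≡ just w) where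
    open GSInvariant I
    open Valid valid

    rejected : List (Fin n)
    rejected = successors m (wlist L w)

    deleted : List (Fin n × Fin n)
    deleted = map (_, w) rejected

    L′ : Lists n
    L′ = deletePairs L deleted

    ⊑ʷ : m′ ∈ wlist L′ w′ → m′ ∈ wlist L w′
    ⊑ʷ = Any-resp-⊆ (proj₂ (deletePairs-⊑ L deleted) _)

    w∈ : w ∈ mlist L m
    w∈ = head-∈ hd

    ∈-rejected⁻ : m′ ∈ rejected → Woman.rank w m < Woman.rank w m′
    ∈-rejected⁻ r = proj₂ (∈-successors⁻ (wlist-sorted w) r)

    ∈-rejected⁺ : m′ ∈ wlist L w → Woman.rank w m < Woman.rank w m′ → m′ ∈ rejected
    ∈-rejected⁺ = ∈-successors⁺ <-asym (wlist-sorted w) (∈ᵐ⇒∈ʷ w∈)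

    m∉rejected : m ∉ rejected
    m∉rejected r = <-irrefl refl (∈-rejected⁻ r)

    ∈-deleted⁻ : (m′ , w′) ∈ deleted → m′ ∈ rejected × w′ ≡ w
    ∈-deleted⁻ del with ∈-map⁻ (_, w) del
    ... | _ , r , refl = r , refl

    keptᵐ : w′ ∈ mlist L m′ → (w′ ≡ w → m′ ∉ rejected) → w′ ∈ mlist L′ m′
    keptᵐ w′∈ ok = ∈-deletePairsᵐ L deleted w′∈ (λ del → let r , eq = ∈-deleted⁻ del in ok eq r)

    lostᵐ : m′ ∈ rejected → w ∉ mlist L′ m′
    lostᵐ r w∈′ = ∉-deletePairsᵐ L deleted w∈′ (∈-map⁺ (_, w) r)

    lostʷ : m′ ∈ wlist L′ w → m′ ∉ rejected
    lostʷ m′∈ r = ∉-deletePairsʷ L deleted m′∈ (∈-map⁺ (_, w) r)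

    valid′ : Valid L′
    valid′ = deletePairs-valid valid suffix
      where
      suffix : ∀ {a w′ m″} → (a , w′) ∈ deleted → m″ ∈ wlist L w′ →
        Woman.rank w′ a < Woman.rank w′ m″ → (m″ , w′) ∈ deleted
      suffix del m″∈ a<m″ with ∈-deleted⁻ del
      ... | r , refl = ∈-map⁺ (_, w) (∈-rejected⁺ m″∈ (<-trans (∈-rejected⁻ r) a<m″))

    -- A stable matching pairing w with a rejected man would be blocked by (m , w).
    admits′ : ∀ M → Stable G M → Admits L₀ M → Admits L′ M
    admits′ M (perfect , unblocked) adm m′ = keptᵐ (admits m′) notRejected
      where
      admits : Admits L M
      admits = admits-stable M (perfect , unblocked) adm
      notRejected : M m′ ≡ w → m′ ∉ rejected
      notRejected Mm′≡w r = unblocked m w (man-prefers , woman-prefers)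
        where
        m<m′ : Woman.rank w m < Woman.rank w m′
        m<m′ = ∈-rejected⁻ r
        Mm≢w : M m ≢ w
        Mm≢w Mm≡w = <-irrefl (cong (Woman.rank w) (perfect (trans Mm≡w (sym Mm′≡w)))) m<m′
        man-prefers : Before (mpref G m) w (M m)
        man-prefers = Man.rank<⇒Before
          (≤∧≢⇒< (head-minimal hd (admits m)) (λ eq → Mm≢w (sym (Man.rank-injective m eq))))
        woman-prefers : ∀ m″ → M m″ ≡ w → Before (wpref G w) m m″
        woman-prefers m″ Mm″≡w rewrite perfect (trans Mm″≡w (sym Mm′≡w)) = Woman.rank<⇒Before m<m′

    head′ : engage E m w m′ ≡ just w′ → head (mlist L′ m′) ≡ just w′
    head′ e with engage⁻ {E = E} {m = m} {w = w} e
    ... | inj₁ (refl , refl) =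
      head-⊆ <-asym (mlist-sorted m) (proj₁ (deletePairs-⊑ L deleted) m) hd
        (keptᵐ w∈ (λ _ → m∉rejected))
    ... | inj₂ (e′ , w′≢w) =
      head-⊆ <-asym (mlist-sorted _) (proj₁ (deletePairs-⊑ L deleted) _) (engaged-head e′)
        (keptᵐ (head-∈ (engaged-head e′)) (⊥-elim ∘ w′≢w))

    last′ : ∀ {m″} → engage E m w m′ ≡ just w′ → m″ ∈ wlist L′ w′ →
      Woman.rank w′ m″ ≤ Woman.rank w′ m′
    last′ e m″∈ with engage⁻ {E = E} {m = m} {w = w} e
    ... | inj₁ (refl , refl) = ≮⇒≥ (λ m<m″ → lostʷ m″∈ (∈-rejected⁺ (⊑ʷ m″∈) m<m″))
    ... | inj₂ (e′ , _)      = engaged-last e′ (⊑ʷ m″∈)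

    invariant′ : GSInvariant L₀ L′ (engage E m w)
    invariant′ = record
      { valid = valid′ ; ⊑-start = ⊑-trans (deletePairs-⊑ L deleted) ⊑-start
      ; admits-stable = admits′ ; engaged-head = head′ ; engaged-last = last′ }

    private
      contribution : Lists n → Engagement n → Fin n → ℕ
      contribution L E m = unmatched (E m) + length (mlist L m)

      shorter : ∀ m′ → length (mlist L′ m′) ≤ length (mlist L m′)
      shorter m′ = length-mono-≤ (proj₁ (deletePairs-⊑ L deleted) m′)

      proposer-< : contribution L′ (engage E m w) m < contribution L E m
      proposer-< rewrite engage-self {E = E} {m} {w} | free = s≤s (shorter m)

      other-≤ : ∀ m′ → m′ ≢ m →
        unmatched (freeIfWith w (E m′)) + length (mlist L′ m′) ≤ contribution L E m′
      other-≤ m′ m′≢m with E m′ in eq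
      ... | nothing = s≤s (shorter m′)
      ... | just w₁ with w₁ ≟ w
      ...   | no _     = shorter m′
      ...   | yes refl = ⊆-length-< (proj₁ (deletePairs-⊑ L deleted) m′) (head-∈ (engaged-head eq))
                           (lostᵐ (∈-rejected⁺ (∈ᵐ⇒∈ʷ (head-∈ (engaged-head eq))) m<m′))
        where
        m<m′ : Woman.rank w m < Woman.rank w m′
        m<m′ = ≤∧≢⇒< (engaged-last eq (∈ᵐ⇒∈ʷ w∈)) (λ eq′ → m′≢m (sym (Woman.rank-injective w eq′)))

      contribution-≤ : ∀ m′ → contribution L′ (engage E m w) m′ ≤ contribution L E m′
      contribution-≤ m′ with m′ ≟ m
      ... | yes refl rewrite free = m≤n⇒m≤1+n (shorter m)
      ... | no m′≢m  = other-≤ m′ m′≢m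

    potential-decreases : potential L′ (engage E m w) < potential L E
    potential-decreases = sum-map-mono-< _ _ (allFin n) contribution-≤ (∈-allFin m) proposer-<

  GSTerminates : Lists n → Engagement n → Set
  GSTerminates L E = Σ (Lists n) λ L′ → Σ (Matching n) λ X → Σ (Engagement n) λ E′ →
    Star GSStep (L , E) (L′ , E′) × (∀ m → E′ m ≡ just (X m))

  record ProposalsAvailable (L₀ : Lists n) : Set₁ where
    field
      Side       : Lists n → Engagement n → Set
      side-start : Side L₀ allFree
      side-step  : (I : GSInvariant L₀ L E) → Side L E → (free : E m ≡ nothing)
                  (hd : head (mlist L m) ≡ just w) → Side (Proposal.L′ I free hd) (engage E m w)
      has-next   : GSInvariant L₀ L E → Side L E → E m ≡ nothing → ∃ λ w → head (mlist L m) ≡ just w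

  gs-terminates : (P : ProposalsAvailable L₀) → GSInvariant L₀ L E →
    ProposalsAvailable.Side P L E → GSTerminates L E
  gs-terminates {L₀} P I side = go I side (<-wellFounded _)
    where
    open ProposalsAvailable P
    go : ∀ {L E} → GSInvariant L₀ L E → Side L E → Acc _<_ (potential L E) → GSTerminates L E
    go {L} {E} I side (acc rs) with any? (λ m → ≡-dec _≟_ (E m) nothing)
    ... | yes (m , free) =
      let w , hd = has-next I side free
          L′ , X , E′ , run , total = go (Proposal.invariant′ I free hd) (side-step I side free hd)
                                         (rs (Proposal.potential-decreases I free hd))
      in L′ , X , E′ , propose L E m w free hd ◅ run , total
    ... | no noneFree = L , (λ m → proj₁ (engaged m)) , E , ε , (λ m → proj₂ (engaged m))
      where
      engaged : ∀ m → ∃ λ w → E m ≡ just w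
      engaged m = ≢nothing⇒just (λ free → noneFree (m , free))

  admits-available : ∀ M → Stable G M → Admits L₀ M → ProposalsAvailable L₀
  admits-available M stable adm = record
    { Side       = λ _ _ → ⊤
    ; side-start = tt
    ; side-step  = λ _ _ _ _ → tt
    ; has-next   = λ {_} {_} {m} I _ _ → head-just (GSInvariant.admits-stable I M stable adm m)
    }

  -- If a free man's list were empty, every woman would be engaged, to distinct men, so no man
  -- would be free.
  initial-available : ProposalsAvailable (initialLists G)
  initial-available = record
    { Side = Side ; side-start = λ m w w∉ → contradiction (Man.∈-pref m w) w∉
    ; side-step = side-step ; has-next = has-next }
    where
    Side : Lists n → Engagement n → Set
    Side L E = ∀ m w → w ∉ mlist L m → ∃ λ m′ → E m′ ≡ just w

    side-step : (I : GSInvariant (initialLists G) L E) → Side L E → (free : E m ≡ nothing)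
      (hd : head (mlist L m) ≡ just w) → Side (Proposal.L′ I free hd) (engage E m w)
    side-step {L} {E} {m} {w} I side free hd m₁ w₁ w₁∉ with w₁ ≟ w
    ... | yes refl = m , engage-self {E = E}
    ... | no w₁≢w with w₁ ∈? mlist L m₁
    ...   | yes w₁∈ = contradiction (Proposal.keptᵐ I free hd w₁∈ (⊥-elim ∘ w₁≢w)) w₁∉
    ...   | no w₁∉′ = let m′ , e = side m₁ w₁ w₁∉′ in m′ , engage-keeps {E = E} free e w₁≢w

    has-next : GSInvariant (initialLists G) L E → Side L E → E m ≡ nothing →
      ∃ λ w → head (mlist L m) ≡ just w
    has-next {L} {E} {m} _ side free with mlist L m in eq
    ... | w ∷ _ = w , refl
    ... | []    = contradiction (trans (sym free) (proj₂ (all-engaged m))) λ ()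
      where
      all-engaged : ∀ m′ → ∃ λ w → E m′ ≡ just w
      all-engaged = women-engaged⇒men-engaged
        (λ w → side m w (λ w∈ → case subst (w ∈_) eq w∈ of λ ()))

  GSInvariant-run : ∀ {s s′} → GSInvariant L₀ (proj₁ s) (proj₂ s) → Star GSStep s s′ →
    GSInvariant L₀ (proj₁ s′) (proj₂ s′)
  GSInvariant-run I ε                                = I
  GSInvariant-run I (propose _ _ _ _ free hd ◅ run) = GSInvariant-run (Proposal.invariant′ I free hd) run

  -- Abstracting head (mlist L m) in the type of fromPairsOf lets the where-bound pairsOf of
  -- roundPairs compute.
  ∈-roundPairs⁺ : ∀ {L} {X : Matching n} → (∀ m → head (mlist L m) ≡ just (X m)) →
    ∀ m → (m , X m) ∈ roundPairs L
  ∈-roundPairs⁺ {L} {X} heads m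
    with (_ → (m , X m) ∈ roundPairs L) ∋ (λ p∈ → ∈-concat⁺′ p∈ (∈-map⁺ _ (∈-allFin m)))
  ... | fromPairsOf with head (mlist L m) | heads m
  ... | .(just (X m)) | refl = fromPairsOf (here refl)

  ∈-roundPairs⁻ : ∀ {L} {X : Matching n} → (∀ m → head (mlist L m) ≡ just (X m)) →
    (∀ m → last (wlist L (X m)) ≡ just m) → (a , w) ∈ roundPairs L → w ≡ X a
  ∈-roundPairs⁻ {L = L} {X} heads lasts p∈ with ∈-concat⁻′ (map _ (allFin n)) p∈
  ... | _ , p∈pairs , pairs∈ with ∈-map⁻ _ pairs∈
  ... | m , _ , refl with head (mlist L m) | heads m
  ... | .(just (X m)) | refl with last (wlist L (X m)) | lasts m
  ... | .(just m) | refl with p∈pairs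
  ... | here refl         = refl
  ... | there (here refl) = refl

  menListsLength : Lists n → ℕ
  menListsLength L = sum (map (λ m → length (mlist L m)) (allFin n))

  record GSOutcome (L₀ L : Lists n) (X : Matching n) : Set where
    field
      valid         : Valid L
      ⊑-start       : L ⊑ L₀
      admits-stable : ∀ M → Stable G M → Admits L₀ M → Admits L M
      X-head        : ∀ m → head (mlist L m) ≡ just (X m)
      X-last        : ∀ m → last (wlist L (X m)) ≡ just m

    open Valid valid

    X-admitted : Admits L X
    X-admitted m = head-∈ (X-head m)

    X-man-optimal : ∀ {M} → Admits L M → ∀ m → Man.rank m (X m) ≤ Man.rank m (M m)
    X-man-optimal adm m = head-minimal (X-head m) (adm m)

    X-perfect : Perfect X
    X-perfect {m} {m′} eq = just-injective
      (trans (sym (X-last m)) (subst (λ w → last (wlist L w) ≡ just m′) (sym eq) (X-last m′)))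

    -- A blocking pair (m , w) is impossible: w is gone from m's list, yet w keeps every man
    -- she prefers to her partner.
    X-stable : Stable G X
    X-stable = X-perfect , unblocked
      where
      unblocked : ∀ m w → ¬ Blocks G X m w
      unblocked m w (man-prefers , woman-prefers) with injective⇒surjective X-perfect w
      ... | p , refl =
        <-irrefl refl (<-≤-trans (Man.Before⇒rank< man-prefers) (head-minimal (X-head m) w∈))
        where
        p∈ : p ∈ wlist L (X p)
        p∈ = ∈ᵐ⇒∈ʷ (X-admitted p)
        w∈ : X p ∈ mlist L m
        w∈ = ∈ʷ⇒∈ᵐ (keeps-preferred p∈ (Woman.Before⇒rank< (woman-prefers p refl)))

    next : Lists n
    next = deletePairs L (roundPairs L)

    ∈-next⁻ : ∀ {m w} → w ∈ mlist next m → w ≢ X m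
    ∈-next⁻ {m} w∈ refl = ∉-deletePairsᵐ L (roundPairs L) w∈ (∈-roundPairs⁺ X-head m)

    ∈-next⁺ : ∀ {m w} → w ∈ mlist L m → w ≢ X m → w ∈ mlist next m
    ∈-next⁺ w∈ w≢Xm = ∈-deletePairsᵐ L (roundPairs L) w∈ (w≢Xm ∘ ∈-roundPairs⁻ X-head X-last)

    admits-next : ∀ {M} → Admits L M → EdgeDisjoint X M → Admits next M
    admits-next adm disj m = ∈-next⁺ (adm m) (disj m ∘ sym)

    next-shortens : ∀ {L′} → L′ ⊑ next → Fin n → menListsLength L′ < menListsLength L
    next-shortens L′⊑next m₀ = ≤-<-trans
      (sum-map-mono-≤ _ _ (allFin n) (λ m → length-mono-≤ (proj₁ L′⊑next m)))
      (sum-map-mono-< _ _ (allFin n) (λ m → length-mono-≤ (next⊆ m)) (∈-allFin m₀)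
        (⊆-length-< (next⊆ m₀) (X-admitted m₀) (λ Xm₀∈ → ∈-next⁻ Xm₀∈ refl)))
      where
      next⊆ : ∀ m → mlist next m ⊆ mlist L m
      next⊆ = proj₁ (deletePairs-⊑ L (roundPairs L))

    -- Each woman loses only her current partner, the last man on her list.
    next-valid : Valid next
    next-valid = deletePairs-valid valid final
      where
      final : ∀ {a w m′} → (a , w) ∈ roundPairs L → m′ ∈ wlist L w →
        Woman.rank w a < Woman.rank w m′ → (m′ , w) ∈ roundPairs L
      final p∈ m′∈ a<m′ with ∈-roundPairs⁻ X-head X-last p∈
      ... | refl with last-greatest (wlist-sorted _) (X-last _) m′∈
      ...   | inj₁ refl  = contradiction a<m′ (<-irrefl refl)
      ...   | inj₂ m′<a  = contradiction a<m′ (<-asym m′<a)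

  gs-outcome : ∀ {L X} → Valid L₀ → GSExtended L₀ L X → GSOutcome L₀ L X
  gs-outcome {L₀} {L} {X} V (E , run , total) = record
    { valid = valid ; ⊑-start = ⊑-start ; admits-stable = admits-stable
    ; X-head = λ m → engaged-head (total m) ; X-last = X-last }
    where
    open GSInvariant (GSInvariant-run (GSInvariant-start V) run)
    open Valid valid
    partner∈ : ∀ m → m ∈ wlist L (X m)
    partner∈ m = ∈ᵐ⇒∈ʷ (head-∈ (engaged-head (total m)))
    X-last : ∀ m → last (wlist L (X m)) ≡ just m
    X-last m with last-just (partner∈ m)
    ... | y , eq with last-greatest (wlist-sorted (X m)) eq (partner∈ m)
    ...   | inj₁ refl = eq
    ...   | inj₂ m<y  = contradiction (engaged-last (total m) (last-∈ eq)) (<⇒≱ m<y)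

  -- The loop of the Disjoint Stable Matchings algorithm

  ManPessimal : Matching n → Set
  ManPessimal Mz = ∀ M → Stable G M → ∀ m → Man.rank m (M m) ≤ Man.rank m (Mz m)

  WomanOptimal⇒ManPessimal : ∀ {Mz} → WomanOptimal G Mz → ManPessimal Mz
  WomanOptimal⇒ManPessimal {Mz} (_ , optimal) M stable@(_ , unblocked) m = ≮⇒≥ Mz-blocks
    where
    Mz-blocks : ¬ Man.rank m (Mz m) < Man.rank m (M m)
    Mz-blocks Mz<M = unblocked m (Mz m) (Man.rank<⇒Before Mz<M , woman-prefers)
      where
      woman-prefers : ∀ m′ → M m′ ≡ Mz m → Before (wpref G (Mz m)) m m′
      woman-prefers m′ eq with optimal M stable m m′ (sym eq)
      ... | inj₁ refl   = contradiction (cong (Man.rank m) eq) (<⇒≢ Mz<M ∘ sym)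
      ... | inj₂ before = before

  ChainBound : Lists n → List (Matching n) → Set
  ChainBound L S = ∀ C → DisjointStableChain G C → All (Admits L) C → length C ≤ length S

  -- At most one member Y of the chain meets X: members dominated by Y are worse than X for
  -- every man, and a member dominating Y would beat X where Y meets it.
  avoiding-subchain : ∀ {L X} → (∀ {M} → Admits L M → ∀ m → Man.rank m (X m) ≤ Man.rank m (M m)) →
    ∀ C → All (Admits L) C → AllPairs (Comparable G) C →
    ∃ λ C′ → C′ ⊆ C × All (EdgeDisjoint X) C′ × length C ≤ suc (length C′)
  avoiding-subchain optimal [] [] [] = [] , [] , [] , z≤n
  avoiding-subchain {L} {X} optimal (Y ∷ C) (admY ∷ adm) (cmpY ∷ cmp) with any? (λ m → X m ≟ Y m)
  ... | no apart =
    let C′ , σ , disj , len = avoiding-subchain {L} {X} optimal C adm cmp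
    in Y ∷ C′ , refl ∷ σ , (λ m eq → apart (m , eq)) ∷ disj , s≤s len
  ... | yes (m₀ , meet) = C , Y ∷ʳ ⊆-refl , All.zipWith apart (cmpY , adm) , ≤-refl
    where
    apart : ∀ {Z} → Comparable G Y Z × Admits L Z → EdgeDisjoint X Z
    apart (inj₁ Y≺Z , _) m eq =
      <-irrefl (cong (Man.rank m) eq) (≤-<-trans (optimal admY m) (Man.Before⇒rank< (Y≺Z m)))
    apart (inj₂ Z≺Y , admZ) _ _ =
      <-irrefl (cong (Man.rank m₀) meet) (≤-<-trans (optimal admZ m₀) (Man.Before⇒rank< (Z≺Y m₀)))

  DisjointStableChain-resp-⊆ : ∀ {C′ C} → C′ ⊆ C → DisjointStableChain G C → DisjointStableChain G C′
  DisjointStableChain-resp-⊆ σ (stable , cmp , disj) =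
    All-resp-⊆ σ stable , AllPairs-resp-⊆ σ cmp , AllPairs-resp-⊆ σ disj

  module _ {Mz : Matching n} (Mz-stable : Stable G Mz) (Mz-pessimal : ManPessimal Mz) where

    LoopResult : Lists n → List (Matching n) → Set
    LoopResult L S = DisjointStableChain G S × All (Admits L) S × ChainBound L S

    -- When X meets Mz, X and Mz are the best and worst admitted stable matchings for the man
    -- where they meet, so no member of a chain avoids X.
    finish-result : ∀ {L₀ L X m₀} → GSOutcome L₀ L X → X m₀ ≡ Mz m₀ → Admits L Mz → LoopResult L (Mz ∷ [])
    finish-result {L = L} {X} {m₀} O meet admMz =
      (Mz-stable ∷ [] , [] ∷ [] , [] ∷ []) , admMz ∷ [] , bound
      where
      open GSOutcome O
      bound : ChainBound L (Mz ∷ [])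
      bound C (stable , cmp , _) adm with avoiding-subchain {L} {X} X-man-optimal C adm cmp
      ... | [] , _ , _ , len = len
      ... | Z ∷ _ , σ , disjZ ∷ _ , _ with All-resp-⊆ σ stable | All-resp-⊆ σ adm
      ...   | stableZ ∷ _ | admZ ∷ _ =
        contradiction (Man.rank-injective m₀ (≤-antisym X≤Z Z≤X)) (disjZ m₀)
        where
        X≤Z : Man.rank m₀ (X m₀) ≤ Man.rank m₀ (Z m₀)
        X≤Z = X-man-optimal admZ m₀
        Z≤X : Man.rank m₀ (Z m₀) ≤ Man.rank m₀ (X m₀)
        Z≤X = subst (λ w → Man.rank m₀ (Z m₀) ≤ Man.rank m₀ w) (sym meet) (Mz-pessimal Z stableZ m₀)

    extend-result : ∀ {L₀ L X L′ X′ S} (O : GSOutcome L₀ L X) → GSOutcome (GSOutcome.next O) L′ X′ →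
      LoopResult L′ S → LoopResult L (X ∷ S)
    extend-result {L = L} {X} {L′} {S = S} O O′ ((stableS , cmpS , disjS) , admS , boundS) =
      (X-stable ∷ stableS , All.map (inj₁ ∘ X-dominates) admS ∷ cmpS , All.map X-disjoint admS ∷ disjS)
      , X-admitted ∷ All.map (to-L ∘ to-next) admS , bound
      where
      open GSOutcome O
      to-next : ∀ {Y} → Admits L′ Y → Admits next Y
      to-next adm m = Any-resp-⊆ (proj₁ (GSOutcome.⊑-start O′) m) (adm m)
      to-L : ∀ {Y} → Admits next Y → Admits L Y
      to-L adm m = Any-resp-⊆ (proj₁ (deletePairs-⊑ L (roundPairs L)) m) (adm m)
      X-disjoint : ∀ {Y} → Admits L′ Y → EdgeDisjoint X Y
      X-disjoint adm m eq = ∈-next⁻ (to-next adm m) (sym eq)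
      X-dominates : ∀ {Y} → Admits L′ Y → Dominates G X Y
      X-dominates adm m = Man.rank<⇒Before (≤∧≢⇒< (X-man-optimal (to-L (to-next adm)) m)
        (X-disjoint adm m ∘ Man.rank-injective m))
      bound : ChainBound L (X ∷ S)
      bound C chain@(stable , cmp , _) adm with avoiding-subchain {L} {X} X-man-optimal C adm cmp
      ... | C′ , σ , disj , len =
        ≤-trans len (s≤s (boundS C′ (DisjointStableChain-resp-⊆ σ chain) admC′))
        where
        admC′ : All (Admits L′) C′
        admC′ = All.zipWith
          (λ { ((stableZ , admZ) , disjZ) →
                 GSOutcome.admits-stable O′ _ stableZ (admits-next admZ disjZ) })
          (All.zip (All-resp-⊆ σ stable , All-resp-⊆ σ adm) , disj)

    loop-result : ∀ {L₀ L X S} → DSMLoop Mz L X S → GSOutcome L₀ L X → Admits L Mz → LoopResult L S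
    loop-result (finish _ _ (_ , meet)) O admMz = finish-result O meet admMz
    loop-result (iterate _ _ _ _ _ apart gse loop) O admMz =
      extend-result O O′ (loop-result loop O′ (GSOutcome.admits-stable O′ Mz Mz-stable admMz-next))
      where
      open GSOutcome O
      O′ = gs-outcome next-valid gse
      admMz-next : Admits next Mz
      admMz-next = admits-next admMz apart

  GSExtended-exists : Valid L₀ → ProposalsAvailable L₀ →
    Σ (Lists n) λ L → Σ (Matching n) λ X → GSExtended L₀ L X
  GSExtended-exists V P with gs-terminates P (GSInvariant-start V) (ProposalsAvailable.side-start P)
  ... | L , X , E , run , total = L , X , E , run , total

  -- Each round removes X m₀ from the list of the man m₀, so the loop stops; here n ≥ 1 is needed.
  loop-terminates : ∀ {Mz L₀ L X} → Stable G Mz → Fin n → GSOutcome L₀ L X → Admits L Mz →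
    ∃ λ S → DSMLoop Mz L X S
  loop-terminates {Mz} Mz-stable m₀ O admMz = go O admMz (<-wellFounded _)
    where
    go : ∀ {L₀ L X} → GSOutcome L₀ L X → Admits L Mz → Acc _<_ (menListsLength L) →
      ∃ λ S → DSMLoop Mz L X S
    go {L = L} {X} O admMz (acc rs) with any? (λ m → X m ≟ Mz m)
    ... | yes meet = Mz ∷ [] , finish L X meet
    ... | no meets =
      let open GSOutcome O
          disjoint = λ m eq → meets (m , eq)
          admMz-next = admits-next admMz disjoint
          L′ , X′ , gse = GSExtended-exists next-valid (admits-available Mz Mz-stable admMz-next)
          O′ = gs-outcome next-valid gse
          S , loop = go O′ (GSOutcome.admits-stable O′ Mz Mz-stable admMz-next)
                        (rs (next-shortens (GSOutcome.⊑-start O′) m₀))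
      in X ∷ S , iterate L X L′ X′ S disjoint gse loop

  admits-initial : ∀ M → Admits (initialLists G) M
  admits-initial M m = Man.∈-pref m (M m)

  DSM-sound : ∀ {S} → DSM G S →
    DisjointStableChain G S × (∀ C → DisjointStableChain G C → length C ≤ length S)
  DSM-sound (Mz , optimal@(Mz-stable , _) , _ , _ , gse , loop) =
    let O = gs-outcome initial-valid gse
        admits-stable = GSOutcome.admits-stable O
        chain , _ , bound = loop-result Mz-stable (WomanOptimal⇒ManPessimal optimal) loop O
                              (admits-stable Mz Mz-stable (admits-initial Mz))
    in chain , λ C chainC →
         bound C chainC (All.map (λ {M} st → admits-stable M st (admits-initial M)) (proj₁ chainC))

  DSM-complete : ∀ {Mz} → WomanOptimal G Mz → Fin n → ∃ λ S → DSM G S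
  DSM-complete {Mz} optimal@(Mz-stable , _) m₀ =
    let L , X , gse = GSExtended-exists initial-valid (admits-available Mz Mz-stable (admits-initial Mz))
        O = gs-outcome initial-valid gse
        S , loop = loop-terminates Mz-stable m₀ O (GSOutcome.admits-stable O Mz Mz-stable (admits-initial Mz))
    in S , Mz , optimal , L , X , gse , loop

-- Exchanging the roles of men and women

transpose : ∀ {n} → Instance n → Instance n
transpose G = record
  { mpref = wpref G ; wpref = mpref G ; mpref-perm = wpref-perm G ; wpref-perm = mpref-perm G }

module _ {n} {M : Matching n} (perfect : Perfect M) where

  inverse : Matching n
  inverse w = proj₁ (injective⇒surjective perfect w)

  inverseʳ : ∀ w → M (inverse w) ≡ w
  inverseʳ w = proj₂ (injective⇒surjective perfect w)

  inverseˡ : ∀ m → inverse (M m) ≡ m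
  inverseˡ m = perfect (inverseʳ (M m))

  inverse-perfect : Perfect inverse
  inverse-perfect {w} {w′} eq = trans (sym (inverseʳ w)) (trans (cong M eq) (inverseʳ w′))

Stable-transpose : ∀ {n} {G : Instance n} {M} (stable : Stable G M) →
  Stable (transpose G) (inverse (proj₁ stable))
Stable-transpose {G = G} {M} (perfect , unblocked) = inverse-perfect perfect , unblockedᵀ
  where
  unblockedᵀ : ∀ w m → ¬ Blocks (transpose G) (inverse perfect) w m
  unblockedᵀ w m (woman-prefers , man-prefers) =
    unblocked m w (man-prefers (M m) (inverseˡ perfect m) , λ m′ Mm′≡w →
      subst (Before (wpref G w) m) (trans (sym (cong (inverse perfect) Mm′≡w)) (inverseˡ perfect m′))
        woman-prefers)

-- The woman-optimal stable matching is the inverse of the outcome of Gale–Shapley with the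
-- women proposing, which is optimal for the proposing side among all stable matchings.
WomanOptimal-exists : ∀ {n} (G : Instance n) → ∃ λ Mz → WomanOptimal G Mz
WomanOptimal-exists {n} G = Mz , Mz-stable , optimal
  where
  module Gᵀ = Algorithm (transpose G)
  run = Gᵀ.GSExtended-exists Gᵀ.initial-valid Gᵀ.initial-available
  O = Gᵀ.gs-outcome Gᵀ.initial-valid (proj₂ (proj₂ run))
  Mz = inverse (proj₁ (Gᵀ.GSOutcome.X-stable O))
  Mz-stable : Stable G Mz
  Mz-stable = Stable-transpose {G = transpose G} (Gᵀ.GSOutcome.X-stable O)
  optimal : ∀ M → Stable G M → ∀ m m′ → Mz m ≡ M m′ → WeaklyBefore (wpref G (Mz m)) m m′
  optimal M stable m m′ eq with m≤n⇒m<n∨m≡n m≤m′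
    where
    Xᵀ-perfect = proj₁ (Gᵀ.GSOutcome.X-stable O)
    Mᵀ = inverse (proj₁ stable)
    m≤m′ : Gᵀ.Man.rank (Mz m) m ≤ Gᵀ.Man.rank (Mz m) m′
    m≤m′ = subst₂ (λ a b → Gᵀ.Man.rank (Mz m) a ≤ Gᵀ.Man.rank (Mz m) b)
      (inverseʳ Xᵀ-perfect m) (trans (cong Mᵀ eq) (inverseˡ (proj₁ stable) m′))
      (Gᵀ.GSOutcome.X-man-optimal O
        (Gᵀ.GSOutcome.admits-stable O Mᵀ (Stable-transpose {G = G} stable) (Gᵀ.admits-initial Mᵀ)) (Mz m))
  ... | inj₁ m<m′ = inj₂ (Gᵀ.Man.rank<⇒Before m<m′)
  ... | inj₂ m≡m′ = inj₁ (Gᵀ.Man.rank-injective (Mz m) m≡m′)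

lemma7 : (n : ℕ) → 1 ≤ n → (G : Instance n) →
    (∃ λ S → DSM G S) ×
    (∀ S → DSM G S →
      DisjointStableChain G S ×
      (∀ (C : List (Matching n)) → DisjointStableChain G C → length C ≤ length S))
lemma7 (suc _) _ G =
  Algorithm.DSM-complete G (proj₂ (WomanOptimal-exists G)) zero , λ _ → Algorithm.DSM-sound G
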